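{- If $G$ is a connected chordal graph, then $\gamma_b(G)\le \left\lceil \frac{3}{2}\,\mathrm{mp}(G)\right\rceil$.
   Context: All graphs are finite, simple and undirected. A graph is chordal if every cycle on at least four vertices has a chord. For a connected graph $G=(V,E)$, $d(u,v)$ is the shortest-path distance, $\mathrm{diam}(G)$ is the diameter, and $N_r[v]=\{u\in V: d(u,v)\le r\}$. A broadcast is a function $f:V\to\{0,1,\dots,\mathrm{diam}(G)\}$; it is dominating if for every $u\in V$ there is $v\in V$ with $f(v)>0$ and $d(u,v)\le f(v)$. Its cost is $\sum_{v\in V}f(v)$, and $\gamma_b(G)$ (the broadcast domination number) is the minimum cost of a dominating broadcast. A multipacking is a set $M\subseteq V$ with $|N_r[v]\cap M|\le r$ for all $v\in V$ and all integers $r\ge1$; $\mathrm{mp}(G)$ is the maximum size of a multipacking. -}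

module Defs where

open import Data.Nat using (ℕ; zero; suc; _+_; _≤_; _∸_)
open import Data.Bool using (Bool; true; false; T; _∨_; _∧_; if_then_else_)
open import Data.Fin using (Fin; toℕ)
open import Data.Fin.Subset using (Subset; ⁅_⁆; _∪_; _∩_; _∈_; ∣_∣)
open import Data.Vec using (tabulate; lookup)
open import Data.List using (any)
open import Data.List using (List)
open import Data.Fin using () renaming (zero to fzero)
open import Data.Product using (Σ; ∃; _×_; _,_)
open import Relation.Binary.PropositionalEquality using (_≡_; _≢_)
open import Relation.Nullary using (¬_)
open import Function.Definitions using (Injective)
open import Data.Vec.Base using (foldr)
open import Data.Fin.Base using (Fin)

record Graph (n : ℕ) : Set where
  field
    adj   : Fin n → Fin n → Bool
    symm  : ∀ u v → adj u v ≡ adj v u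
    irrefl : ∀ v → adj v v ≡ false

module _ {n : ℕ} (G : Graph n) where
  open Graph G

  Adj : Fin n → Fin n → Set
  Adj u v = T (adj u v)

  expand : Subset n → Subset n
  expand S = tabulate λ u →
    lookup S u ∨ foldr (λ _ → Bool) (λ b acc → b ∨ acc) false
                   (tabulate λ w → lookup S w ∧ adj w u)

  -- ball r v = N_r[v] = { u : d(u,v) ≤ r }
  ball : ℕ → Fin n → Subset n
  ball zero    v = ⁅ v ⁆
  ball (suc r) v = expand (ball r v)

  WithinDist : ℕ → Fin n → Fin n → Set
  WithinDist r u v = u ∈ ball r v

  Connected : Set
  Connected = ∀ u v → ∃ λ r → WithinDist r u v

  Dist : Fin n → Fin n → ℕ → Set
  Dist u v d = WithinDist d u v × (∀ k → WithinDist k u v → d ≤ k)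

  IsDiameter : ℕ → Set
  IsDiameter D = (∀ u v → ∃ λ d → Dist u v d × d ≤ D)
               × (∃ λ u → ∃ λ v → Dist u v D)

  Consecutive : {k : ℕ} → Fin k → Fin k → Set
  Consecutive {k} i j = (toℕ j ≡ suc (toℕ i))
                      ⊎' (toℕ i ≡ k ∸ 1 × toℕ j ≡ 0)
    where
    open import Data.Sum using () renaming (_⊎_ to _⊎'_)

  IsCycle : (k : ℕ) → (Fin k → Fin n) → Set
  IsCycle k c = Injective _≡_ _≡_ c × (∀ i j → Consecutive i j → Adj (c i) (c j))

  HasChord : (k : ℕ) → (Fin k → Fin n) → Set
  HasChord k c = ∃ λ i → ∃ λ j → i ≢ j × ¬ Consecutive i j × ¬ Consecutive j i
                                 × Adj (c i) (c j)

  Chordal : Set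
  Chordal = ∀ k → 4 ≤ k → (c : Fin k → Fin n) → IsCycle k c → HasChord k c

  IsBroadcast : (Fin n → ℕ) → Set
  IsBroadcast f = ∀ v D → IsDiameter D → f v ≤ D

  IsDominating : (Fin n → ℕ) → Set
  IsDominating f = ∀ u → ∃ λ v → 1 ≤ f v × WithinDist (f v) u v

  cost : (Fin n → ℕ) → ℕ
  cost f = foldr (λ _ → ℕ) _+_ 0 (tabulate f)

  IsBroadcastDomNumber : ℕ → Set
  IsBroadcastDomNumber g =
    (∃ λ f → IsBroadcast f × IsDominating f × cost f ≡ g)
    × (∀ f → IsBroadcast f → IsDominating f → g ≤ cost f)

  IsMultipacking : Subset n → Set
  IsMultipacking M = ∀ v r → 1 ≤ r → ∣ ball r v ∩ M ∣ ≤ r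

  IsMultipackingNumber : ℕ → Set
  IsMultipackingNumber m =
    (∃ λ M → IsMultipacking M × ∣ M ∣ ≡ m)
    × (∀ M → IsMultipacking M → ∣ M ∣ ≤ m)

{-# OPTIONS --safe #-}
-- Let D be the diameter and k = ⌊D/2⌋. Two vertices are joined by a walk of length at most
-- 2k + 1, so any two balls of radius k meet or are joined by an edge. In a chordal graph a
-- family of pairwise touching connected vertex sets has a vertex within distance 1 of all of
-- them (peel off simplicial vertices, which exist by Dirac's lemma). Hence one vertex
-- broadcasting with strength k + 1 dominates, and γ_b ≤ ⌊D/2⌋ + 1. Conversely the vertices at
-- positions 0, 3, 6, … of a diametral path form a multipacking, so mp ≥ ⌊D/3⌋ + 1; finally
-- ⌊D/2⌋ + 1 ≤ ⌈3(⌊D/3⌋ + 1)/2⌉.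
module Submission where

open import Defs
open import Data.Nat using (ℕ; _*_; _≤_; ⌈_/2⌉)

open import Data.Bool using (Bool; true; false; T; _∨_)
open import Data.Bool.Properties using (T-∨; T-∧; T-≡)
open import Data.Empty using (⊥-elim)
open import Data.Fin using (Fin; toℕ) renaming (zero to fzero; suc to fsuc)
open import Data.Fin.Properties using (any?; ¬∀⟶∃¬; toℕ-injective; toℕ≤pred[n]) renaming (_≟_ to _≟ᶠ_)
open import Data.Fin.Subset
  using (Subset; ⁅_⁆; _∪_; _∩_; _─_; _-_; ∣_∣; _∈_; _∉_; _⊆_; _⊈_; _⊂_; _⊃_; ⊥; ⊤; Nonempty)
open import Data.Fin.Subset.Properties
  using (_∈?_; _⊆?_; nonempty?; ∣⊥∣≡0; x∉⁅y⁆⇒x≢y; ∣⁅x⁆∣≡1; x∈⁅x⁆; x∈⁅y⁆⇒x≡y; ∉⊥; ∈⊤; x∈p∪q⁺; x∈p∪q⁻; x∈p∩q⁻;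
         p⊆q⇒∣p∣≤∣q∣; p⊂q⇒∣p∣<∣q∣; p⊆p∪q; x∈p∧x≢y⇒x∈p-y; p─q⊆p; x∈p⇒p-x⊂p)
open import Data.Fin.Subset.Induction using (Acc; acc; ⊂-wellFounded; ⊃-wellFounded)
open import Data.Nat using (zero; suc; _+_; _∸_; _<_; _≤?_; z≤n; s≤s; ⌊_/2⌋)
open import Data.Nat.Induction using (<-wellFounded)
open import Data.Nat.Properties
  using (≤-refl; ≤-trans; ≤-reflexive; ≤-antisym; <⇒≤; ≤-pred; m≤n⇒m≤1+n; ≰⇒>; ≤∧≢⇒<; <⇒≢; <⇒≱;
         suc-injective; <-cmp; m≤n⇒m<n∨m≡n; ∸-monoˡ-<; m+n∸m≡n;
         +-suc; +-assoc; +-comm; +-identityʳ; +-monoˡ-≤; +-monoʳ-≤; +-mono-≤; +-monoʳ-<; +-cancelʳ-≤;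
         m≤m+n; m+[n∸m]≡n; m≤n+o⇒m∸n≤o; *-distribˡ-+; *-monoʳ-≤; *-cancelˡ-<; *-cancelˡ-≤; *-monoˡ-<;
         ⌊n/2⌋<n; ⌈n/2⌉-mono; anyUpTo?)
open import Data.Product using (∃; ∃₂; _×_; _,_; proj₁; proj₂)
open import Data.Sum using (_⊎_; inj₁; inj₂; [_,_]′)
open import Data.Unit using (tt)
open import Data.Vec using (_∷_; []; tabulate; lookup; foldr; sum; here; there)
open import Data.Vec.Properties using (lookup∘tabulate; []=⇒lookup; lookup⇒[]=)
open import Function using (_∘_; id)
open import Function.Definitions using (Injective)
open import Function.Bundles using (Equivalence)
open import Relation.Binary.Definitions using (tri<; tri≈; tri>)
open import Relation.Binary.PropositionalEquality using (_≡_; _≢_; refl; sym; trans; cong; subst; ≢-sym)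
open import Relation.Nullary using (¬_; Dec; yes; no; contradiction)
open import Relation.Nullary.Decidable
  using (_×-dec_; _⊎-dec_; _→-dec_; ¬?; T?; isYes; toWitness; fromWitness; decidable-stable)
open import Relation.Unary using (Decidable; U)

⌊_/3⌋ : ℕ → ℕ
⌊ suc (suc (suc n)) /3⌋ = suc ⌊ n /3⌋
⌊ _ /3⌋ = 0

3*⌊n/3⌋≤n : ∀ n → 3 * ⌊ n /3⌋ ≤ n
3*⌊n/3⌋≤n (suc (suc (suc n))) rewrite *-distribˡ-+ 3 1 ⌊ n /3⌋ = s≤s (s≤s (s≤s (3*⌊n/3⌋≤n n)))
3*⌊n/3⌋≤n 0 = z≤n
3*⌊n/3⌋≤n 1 = z≤n
3*⌊n/3⌋≤n 2 = z≤n

n≤⌊n/2⌋+1+⌊n/2⌋ : ∀ n → n ≤ ⌊ n /2⌋ + suc ⌊ n /2⌋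
n≤⌊n/2⌋+1+⌊n/2⌋ 0 = z≤n
n≤⌊n/2⌋+1+⌊n/2⌋ 1 = s≤s z≤n
n≤⌊n/2⌋+1+⌊n/2⌋ (suc (suc n)) rewrite +-suc ⌊ n /2⌋ (suc ⌊ n /2⌋) = s≤s (s≤s (n≤⌊n/2⌋+1+⌊n/2⌋ n))

1+⌊n/2⌋≤n : ∀ {n} → 1 ≤ n → suc ⌊ n /2⌋ ≤ n
1+⌊n/2⌋≤n {suc n} _ = ⌊n/2⌋<n n

1+⌊n/2⌋≤⌈3[1+⌊n/3⌋]/2⌉ : ∀ n → suc ⌊ n /2⌋ ≤ ⌈ 3 * suc ⌊ n /3⌋ /2⌉
1+⌊n/2⌋≤⌈3[1+⌊n/3⌋]/2⌉ 0 = s≤s z≤n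
1+⌊n/2⌋≤⌈3[1+⌊n/3⌋]/2⌉ 1 = s≤s z≤n
1+⌊n/2⌋≤⌈3[1+⌊n/3⌋]/2⌉ 2 = s≤s (s≤s z≤n)
1+⌊n/2⌋≤⌈3[1+⌊n/3⌋]/2⌉ 3 = s≤s (s≤s z≤n)
1+⌊n/2⌋≤⌈3[1+⌊n/3⌋]/2⌉ 4 = s≤s (s≤s (s≤s z≤n))
1+⌊n/2⌋≤⌈3[1+⌊n/3⌋]/2⌉ 5 = s≤s (s≤s (s≤s z≤n))
1+⌊n/2⌋≤⌈3[1+⌊n/3⌋]/2⌉ (suc (suc (suc (suc (suc (suc n)))))) =
  subst (λ k → 4 + ⌊ n /2⌋ ≤ ⌈ k /2⌉) (sym (*-distribˡ-+ 3 2 (suc ⌊ n /3⌋)))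
        (s≤s (s≤s (s≤s (1+⌊n/2⌋≤⌈3[1+⌊n/3⌋]/2⌉ n))))

3j≤3i+2r⇒j<i+r : ∀ {i j r} → 1 ≤ r → 3 * j ≤ 3 * i + 2 * r → j < i + r
3j≤3i+2r⇒j<i+r {i} {j} {r@(suc _)} _ 3j≤ = *-cancelˡ-< 3 j (i + r) (begin-strict
  3 * j             ≤⟨ 3j≤ ⟩
  3 * i + 2 * r     <⟨ +-monoʳ-< (3 * i) (*-monoˡ-< r (≤-refl {3})) ⟩
  3 * i + 3 * r     ≡⟨ *-distribˡ-+ 3 i r ⟨
  3 * (i + r)       ∎)
  where open Data.Nat.Properties.≤-Reasoning

least-witness : ∀ {P : ℕ → Set} → Decidable P → ∀ {r} → P r → ∃ λ k → P k × (∀ j → P j → k ≤ j)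
least-witness P? {zero} p = 0 , p , λ _ _ → z≤n
least-witness P? {suc r} p with P? 0
... | yes p₀ = 0 , p₀ , λ _ _ → z≤n
... | no ¬p₀ with least-witness (P? ∘ suc) p
...   | k , pk , least = suc k , pk , λ { zero p₀ → contradiction p₀ ¬p₀ ; (suc j) pj → s≤s (least j pj) }

argmax : ∀ {k} (h : Fin (suc k) → ℕ) → ∃ λ i → ∀ j → h j ≤ h i
argmax {zero} h = fzero , λ { fzero → ≤-refl }
argmax {suc k} h with argmax (h ∘ fsuc)
... | i , max with h fzero ≤? h (fsuc i)
...   | yes h₀≤ = fsuc i , λ { fzero → h₀≤ ; (fsuc j) → max j }
...   | no h₀≰ = fzero , λ { fzero → ≤-refl ; (fsuc j) → ≤-trans (max j) (<⇒≤ (≰⇒> h₀≰)) }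

T-or-tabulate⁻ : ∀ {m} (h : Fin m → Bool) →
  T (foldr (λ _ → Bool) (λ b acc → b ∨ acc) false (tabulate h)) → ∃ λ w → T (h w)
T-or-tabulate⁻ {suc m} h t with Equivalence.to T-∨ t
... | inj₁ t₀ = fzero , t₀
... | inj₂ t₁ = let w , tw = T-or-tabulate⁻ (h ∘ fsuc) t₁ in fsuc w , tw

T-or-tabulate⁺ : ∀ {m} (h : Fin m → Bool) w → T (h w) →
  T (foldr (λ _ → Bool) (λ b acc → b ∨ acc) false (tabulate h))
T-or-tabulate⁺ h fzero t = Equivalence.from T-∨ (inj₁ t)
T-or-tabulate⁺ h (fsuc w) t = Equivalence.from T-∨ (inj₂ (T-or-tabulate⁺ (h ∘ fsuc) w t))

module _ {n : ℕ} where

  ∈⇒T-lookup : ∀ {p : Subset n} {x} → x ∈ p → T (lookup p x)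
  ∈⇒T-lookup x∈p = Equivalence.from T-≡ ([]=⇒lookup x∈p)

  T-lookup⇒∈ : ∀ {p : Subset n} {x} → T (lookup p x) → x ∈ p
  T-lookup⇒∈ {p} {x} t = lookup⇒[]= x p (Equivalence.to T-≡ t)

  ∈-tabulate⁺ : ∀ {f : Fin n → Bool} {x} → T (f x) → x ∈ tabulate f
  ∈-tabulate⁺ {f} {x} = T-lookup⇒∈ ∘ subst T (sym (lookup∘tabulate f x))

  ∈-tabulate⁻ : ∀ {f : Fin n → Bool} {x} → x ∈ tabulate f → T (f x)
  ∈-tabulate⁻ {f} {x} = subst T (lookup∘tabulate f x) ∘ ∈⇒T-lookup

  subsetOf : {P : Fin n → Set} → Decidable P → Subset n
  subsetOf P? = tabulate (isYes ∘ P?)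

  ∈-subsetOf⁺ : ∀ {P : Fin n → Set} (P? : Decidable P) {x} → P x → x ∈ subsetOf P?
  ∈-subsetOf⁺ P? {x} px = ∈-tabulate⁺ (fromWitness {a? = P? x} px)

  ∈-subsetOf⁻ : ∀ {P : Fin n → Set} (P? : Decidable P) {x} → x ∈ subsetOf P? → P x
  ∈-subsetOf⁻ P? x∈ = toWitness (∈-tabulate⁻ x∈)

  ⊈⇒∃∉ : ∀ {p q : Subset n} → p ⊈ q → ∃ λ x → x ∈ p × x ∉ q
  ⊈⇒∃∉ {p} {q} p⊈q with ¬∀⟶∃¬ n (λ x → x ∈ p → x ∈ q) (λ x → x ∈? p →-dec x ∈? q) (λ p⊆q → p⊈q (p⊆q _))
  ... | x , ¬[p⇒q] = x , decidable-stable (x ∈? p) (λ x∉p → ¬[p⇒q] (λ x∈p → contradiction x∈p x∉p))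
                       , λ x∈q → ¬[p⇒q] (λ _ → x∈q)

repeat-or-injective : ∀ {n} (q : ℕ → Fin n) L →
  (∃₂ λ i j → i < j × j ≤ L × q i ≡ q j) ⊎ (∀ {i j} → i ≤ L → j ≤ L → q i ≡ q j → i ≡ j)
repeat-or-injective q L with anyUpTo? (λ j → anyUpTo? (λ i → q i ≟ᶠ q j) j) (suc L)
... | yes (j , j<1+L , i , i<j , qi≡qj) = inj₁ (i , j , i<j , ≤-pred j<1+L , qi≡qj)
... | no ¬repeat = inj₂ injective
  where
  injective : ∀ {i j} → i ≤ L → j ≤ L → q i ≡ q j → i ≡ j
  injective {i} {j} i≤L j≤L qi≡qj with <-cmp i j
  ... | tri< i<j _ _ = contradiction (j , s≤s j≤L , i , i<j , qi≡qj) ¬repeat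
  ... | tri≈ _ i≡j _ = i≡j
  ... | tri> _ _ j<i = contradiction (i , s≤s i≤L , j , j<i , sym qi≡qj) ¬repeat

x∈p─q⇒x∉q : ∀ {n} (p q : Subset n) {x} → x ∈ p ─ q → x ∉ q
x∈p─q⇒x∉q (true ∷ p) (false ∷ q) here = λ ()
x∈p─q⇒x∉q (_ ∷ p) (_ ∷ q) (there x∈p─q) (there x∈q) = x∈p─q⇒x∉q p q x∈p─q x∈q

x∈p-y⇒x≢y : ∀ {n} {p : Subset n} {x y} → x ∈ p - y → x ≢ y
x∈p-y⇒x≢y {p = p} {y = y} x∈p-y refl = x∈p─q⇒x∉q p ⁅ y ⁆ x∈p-y (x∈⁅x⁆ y)

∣p∪q∣≤∣p∣+∣q∣ : ∀ {n} (p q : Subset n) → ∣ p ∪ q ∣ ≤ ∣ p ∣ + ∣ q ∣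
∣p∪q∣≤∣p∣+∣q∣ [] [] = z≤n
∣p∪q∣≤∣p∣+∣q∣ (true ∷ p) (true ∷ q) = s≤s (≤-trans (∣p∪q∣≤∣p∣+∣q∣ p q) (+-monoʳ-≤ ∣ p ∣ (m≤n⇒m≤1+n ≤-refl)))
∣p∪q∣≤∣p∣+∣q∣ (true ∷ p) (false ∷ q) = s≤s (∣p∪q∣≤∣p∣+∣q∣ p q)
∣p∪q∣≤∣p∣+∣q∣ (false ∷ p) (true ∷ q) rewrite +-suc ∣ p ∣ ∣ q ∣ = s≤s (∣p∪q∣≤∣p∣+∣q∣ p q)
∣p∪q∣≤∣p∣+∣q∣ (false ∷ p) (false ∷ q) = ∣p∪q∣≤∣p∣+∣q∣ p q

module _ {n : ℕ} where

  image : ℕ → (ℕ → Fin n) → Subset n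
  image zero f = ⊥
  image (suc k) f = image k f ∪ ⁅ f k ⁆

  ∈-image⁺ : ∀ k (f : ℕ → Fin n) {i} → i < k → f i ∈ image k f
  ∈-image⁺ (suc k) f i<1+k with m≤n⇒m<n∨m≡n (≤-pred i<1+k)
  ... | inj₁ i<k = x∈p∪q⁺ (inj₁ (∈-image⁺ k f i<k))
  ... | inj₂ refl = x∈p∪q⁺ (inj₂ (x∈⁅x⁆ (f k)))

  ∈-image⁻ : ∀ k (f : ℕ → Fin n) {x} → x ∈ image k f → ∃ λ i → i < k × x ≡ f i
  ∈-image⁻ zero f x∈ = contradiction x∈ ∉⊥
  ∈-image⁻ (suc k) f x∈ with x∈p∪q⁻ (image k f) _ x∈
  ... | inj₁ x∈image = let i , i<k , x≡fi = ∈-image⁻ k f x∈image in i , m≤n⇒m≤1+n i<k , x≡fi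
  ... | inj₂ x∈⁅fk⁆ = k , ≤-refl , x∈⁅y⁆⇒x≡y (f k) x∈⁅fk⁆

  ∣image∣≤ : ∀ k (f : ℕ → Fin n) → ∣ image k f ∣ ≤ k
  ∣image∣≤ zero f = ≤-reflexive (∣⊥∣≡0 n)
  ∣image∣≤ (suc k) f = begin
    ∣ image k f ∪ ⁅ f k ⁆ ∣      ≤⟨ ∣p∪q∣≤∣p∣+∣q∣ (image k f) ⁅ f k ⁆ ⟩
    ∣ image k f ∣ + ∣ ⁅ f k ⁆ ∣  ≤⟨ +-mono-≤ (∣image∣≤ k f) (≤-reflexive (∣⁅x⁆∣≡1 (f k))) ⟩
    k + 1                       ≡⟨ +-comm k 1 ⟩
    suc k                       ∎
    where open Data.Nat.Properties.≤-Reasoning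

  ∣image∣≥ : ∀ k (f : ℕ → Fin n) → (∀ {i j} → i < j → j < k → f i ≢ f j) → k ≤ ∣ image k f ∣
  ∣image∣≥ zero f _ = z≤n
  ∣image∣≥ (suc k) f distinct = ≤-trans (s≤s (∣image∣≥ k f (λ i<j j<k → distinct i<j (m≤n⇒m≤1+n j<k))))
                                       (p⊂q⇒∣p∣<∣q∣ (p⊆p∪q ⁅ f k ⁆ , f k , x∈p∪q⁺ (inj₂ (x∈⁅x⁆ (f k))) , fk∉))
    where
    fk∉ : f k ∉ image k f
    fk∉ fk∈ = let i , i<k , fk≡fi = ∈-image⁻ k f fk∈ in distinct i<k ≤-refl (sym fk≡fi)

  inflationary-fixpoint : (F : Subset n → Subset n) → (∀ R → R ⊆ F R) →
    (Inv : Subset n → Set) → (∀ {R} → Inv R → Inv (F R)) →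
    ∀ {R} → Inv R → ∃ λ R* → Inv R* × F R* ⊆ R*
  inflationary-fixpoint F inflationary Inv preserves = go (⊃-wellFounded _)
    where
    go : ∀ {R} → Acc _⊃_ R → Inv R → ∃ λ R* → Inv R* × F R* ⊆ R*
    go {R} (acc more) inv with F R ⊆? R
    ... | yes FR⊆R = R , inv , FR⊆R
    ... | no FR⊈R = go (more (inflationary R , ⊈⇒∃∉ FR⊈R)) (preserves inv)

pointBroadcast : ∀ {n} → Fin n → ℕ → Fin n → ℕ
pointBroadcast fzero R fzero = R
pointBroadcast fzero R (fsuc _) = 0
pointBroadcast (fsuc _) R fzero = 0
pointBroadcast (fsuc c) R (fsuc v) = pointBroadcast c R v

pointBroadcast-centre : ∀ {n} (c : Fin n) R → pointBroadcast c R c ≡ R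
pointBroadcast-centre fzero R = refl
pointBroadcast-centre (fsuc c) R = pointBroadcast-centre c R

pointBroadcast≤ : ∀ {n} (c : Fin n) R v → pointBroadcast c R v ≤ R
pointBroadcast≤ fzero R fzero = ≤-refl
pointBroadcast≤ fzero R (fsuc _) = z≤n
pointBroadcast≤ (fsuc _) R fzero = z≤n
pointBroadcast≤ (fsuc c) R (fsuc v) = pointBroadcast≤ c R v

sum-pointBroadcast : ∀ {n} (c : Fin n) R → sum (tabulate (pointBroadcast c R)) ≡ R
sum-pointBroadcast {suc n} fzero R = trans (cong (R +_) (sum-zeros n)) (+-identityʳ R)
  where
  sum-zeros : ∀ k → sum (tabulate {n = k} (λ _ → 0)) ≡ 0
  sum-zeros zero = refl
  sum-zeros (suc k) = sum-zeros k
sum-pointBroadcast (fsuc c) R = sum-pointBroadcast c R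

-- Walks and balls

module _ {n : ℕ} (G : Graph n) where
  open Graph G

  infix 4 _~_
  _~_ : Fin n → Fin n → Set
  x ~ y = Adj G x y

  ~-sym : ∀ {x y} → x ~ y → y ~ x
  ~-sym {x} {y} = subst T (symm x y)

  ~-irrefl : ∀ {x} → ¬ x ~ x
  ~-irrefl {x} = subst T (irrefl x)

  ~⇒≢ : ∀ {x y} → x ~ y → x ≢ y
  ~⇒≢ x~x refl = ~-irrefl x~x

  _~?_ : ∀ x y → Dec (x ~ y)
  x ~? y = T? (adj x y)

  Near : Fin n → Fin n → Set
  Near x y = x ≡ y ⊎ x ~ y

  Near? : ∀ x y → Dec (Near x y)
  Near? x y = x ≟ᶠ y ⊎-dec x ~? y

  Near-sym : ∀ {x y} → Near x y → Near y x
  Near-sym (inj₁ refl) = inj₁ refl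
  Near-sym (inj₂ x~y) = inj₂ (~-sym x~y)

  Near∧≢⇒~ : ∀ {x y} → Near x y → x ≢ y → x ~ y
  Near∧≢⇒~ (inj₁ x≡y) x≢y = contradiction x≡y x≢y
  Near∧≢⇒~ (inj₂ x~y) _ = x~y

  ∈-expand⁺ˡ : ∀ {S u} → u ∈ S → u ∈ expand G S
  ∈-expand⁺ˡ u∈S = ∈-tabulate⁺ (Equivalence.from T-∨ (inj₁ (∈⇒T-lookup u∈S)))

  ∈-expand⁺ʳ : ∀ {S u w} → w ∈ S → w ~ u → u ∈ expand G S
  ∈-expand⁺ʳ {w = w} w∈S w~u = ∈-tabulate⁺ (Equivalence.from T-∨ (inj₂
    (T-or-tabulate⁺ _ w (Equivalence.from T-∧ (∈⇒T-lookup w∈S , w~u)))))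

  ∈-expand⁻ : ∀ {S u} → u ∈ expand G S → u ∈ S ⊎ ∃ λ w → w ∈ S × w ~ u
  ∈-expand⁻ u∈ with Equivalence.to T-∨ (∈-tabulate⁻ u∈)
  ... | inj₁ u∈S = inj₁ (T-lookup⇒∈ u∈S)
  ... | inj₂ t with T-or-tabulate⁻ _ t
  ...   | w , tw = let w∈S , w~u = Equivalence.to T-∧ tw in inj₂ (w , T-lookup⇒∈ w∈S , w~u)

  data Walk (P : Fin n → Set) : Fin n → Fin n → ℕ → Set where
    nil  : ∀ {x} → P x → Walk P x x 0
    cons : ∀ {x y z L} → P x → x ~ y → Walk P y z L → Walk P x z (suc L)

  module _ {P : Fin n → Set} where

    sourceP : ∀ {x y L} → Walk P x y L → P x
    sourceP (nil px) = px
    sourceP (cons px _ _) = px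

    snoc : ∀ {x y z L} → Walk P x y L → y ~ z → P z → Walk P x z (suc L)
    snoc (nil px) x~z pz = cons px x~z (nil pz)
    snoc (cons px x~y w) y~z pz = cons px x~y (snoc w y~z pz)

    infixr 5 _++ʷ_
    _++ʷ_ : ∀ {x y z L M} → Walk P x y L → Walk P y z M → Walk P x z (L + M)
    nil _ ++ʷ w′ = w′
    cons px x~y w ++ʷ w′ = cons px x~y (w ++ʷ w′)

    reverse : ∀ {x y L} → Walk P x y L → Walk P y x L
    reverse (nil px) = nil px
    reverse (cons px x~y w) = snoc (reverse w) (~-sym x~y) px

    -- Positions past the end of the walk give its target.
    at : ∀ {x y L} → Walk P x y L → ℕ → Fin n
    at (nil {x} _) _ = x
    at (cons {x} _ _ _) zero = x
    at (cons _ _ w) (suc t) = at w t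

    at-source : ∀ {x y L} (w : Walk P x y L) → at w 0 ≡ x
    at-source (nil _) = refl
    at-source (cons _ _ _) = refl

    at-target : ∀ {x y L} (w : Walk P x y L) → at w L ≡ y
    at-target (nil _) = refl
    at-target (cons _ _ w) = at-target w

    at-P : ∀ {x y L} (w : Walk P x y L) t → P (at w t)
    at-P (nil px) _ = px
    at-P (cons px _ _) zero = px
    at-P (cons _ _ w) (suc t) = at-P w t

    at-~ : ∀ {x y L} (w : Walk P x y L) {t} → t < L → at w t ~ at w (suc t)
    at-~ (cons _ x~y w) {zero} _ = subst (_ ~_) (sym (at-source w)) x~y
    at-~ (cons _ _ w) {suc t} (s≤s t<L) = at-~ w t<L

    prefix : ∀ {x y L} (w : Walk P x y L) t → t ≤ L → Walk P x (at w t) t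
    prefix (nil px) zero _ = nil px
    prefix (cons px _ _) zero _ = nil px
    prefix (cons px x~y w) (suc t) (s≤s t≤L) = cons px x~y (prefix w t t≤L)

    suffix : ∀ {x y L} (w : Walk P x y L) t → t ≤ L → Walk P (at w t) y (L ∸ t)
    suffix (nil px) zero _ = nil px
    suffix (cons px x~y w) zero _ = cons px x~y w
    suffix (cons _ _ w) (suc t) (s≤s t≤L) = suffix w t t≤L

    cut-repeat : ∀ {x y L i j} (w : Walk P x y L) → i < j → j ≤ L → at w i ≡ at w j →
                 ∃ λ L′ → L′ < L × Walk P x y L′
    cut-repeat {y = y} {L} {i} {j} w i<j j≤L wi≡wj =
      i + (L ∸ j) ,
      ≤-trans (+-monoˡ-≤ (L ∸ j) i<j) (≤-reflexive (m+[n∸m]≡n j≤L)) ,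
      prefix w i (≤-trans (<⇒≤ i<j) j≤L) ++ʷ subst (λ u → Walk P u y (L ∸ j)) (sym wi≡wj) (suffix w j j≤L)

    cut-chord : ∀ {x y L i j} (w : Walk P x y L) → suc i < j → j ≤ L → at w i ~ at w j →
                ∃ λ L′ → L′ < L × Walk P x y L′
    cut-chord {L = L} {i} {j} w 1+i<j j≤L wi~wj =
      i + suc (L ∸ j) ,
      ≤-trans (≤-reflexive (cong suc (+-suc i (L ∸ j))))
              (≤-trans (+-monoˡ-≤ (L ∸ j) 1+i<j) (≤-reflexive (m+[n∸m]≡n j≤L))) ,
      prefix w i (≤-trans (<⇒≤ (<⇒≤ 1+i<j)) j≤L) ++ʷ cons (at-P w i) wi~wj (suffix w j j≤L)

  mapʷ : ∀ {P Q : Fin n → Set} → (∀ {x} → P x → Q x) → ∀ {x y L} → Walk P x y L → Walk Q x y L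
  mapʷ f (nil px) = nil (f px)
  mapʷ f (cons px x~y w) = cons (f px) x~y (mapʷ f w)

  ball-mono : ∀ {r s v} → r ≤ s → ball G r v ⊆ ball G s v
  ball-mono {s = zero} z≤n = id
  ball-mono {r} {suc s} r≤1+s with m≤n⇒m<n∨m≡n r≤1+s
  ... | inj₁ (s≤s r≤s) = ∈-expand⁺ˡ ∘ ball-mono r≤s
  ... | inj₂ refl = id

  ball-centre : ∀ r v → v ∈ ball G r v
  ball-centre r v = ball-mono {s = r} z≤n (x∈⁅x⁆ v)

  ball-extend : ∀ {P} j {v x u L} → x ∈ ball G j v → Walk P x u L → u ∈ ball G (j + L) v
  ball-extend j x∈ (nil _) rewrite +-identityʳ j = x∈
  ball-extend j x∈ (cons {L = L} _ x~y w) rewrite +-suc j L = ball-extend (suc j) (∈-expand⁺ʳ x∈ x~y) w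

  walk⇒ball : ∀ {P r v u L} → Walk P v u L → L ≤ r → u ∈ ball G r v
  walk⇒ball {v = v} w L≤r = ball-mono L≤r (ball-extend 0 (x∈⁅x⁆ v) w)

  ball⇒walk : ∀ r {u v} → u ∈ ball G r v → ∃ λ L → L ≤ r × Walk U v u L
  ball⇒walk zero {v = v} u∈ rewrite x∈⁅y⁆⇒x≡y v u∈ = 0 , z≤n , nil tt
  ball⇒walk (suc r) u∈ with ∈-expand⁻ u∈
  ... | inj₁ u∈ball = let L , L≤r , w = ball⇒walk r u∈ball in L , m≤n⇒m≤1+n L≤r , w
  ... | inj₂ (x , x∈ball , x~u) = let L , L≤r , w = ball⇒walk r x∈ball in suc L , s≤s L≤r , snoc w x~u tt

  ball-sym : ∀ r {u v} → u ∈ ball G r v → v ∈ ball G r u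
  ball-sym r u∈ = let _ , L≤r , w = ball⇒walk r u∈ in walk⇒ball (reverse w) L≤r

  ball-trans : ∀ r s {u v w} → u ∈ ball G r v → v ∈ ball G s w → u ∈ ball G (s + r) w
  ball-trans r s u∈ v∈ = let _ , L≤r , w₁ = ball⇒walk r u∈
                             _ , M≤s , w₂ = ball⇒walk s v∈
                         in walk⇒ball (w₂ ++ʷ w₁) (+-mono-≤ M≤s L≤r)

  Near⇒ball-suc : ∀ r {u c y} → Near c y → y ∈ ball G r u → u ∈ ball G (suc r) c
  Near⇒ball-suc r (inj₁ refl) y∈ = ∈-expand⁺ˡ (ball-sym r y∈)
  Near⇒ball-suc r (inj₂ c~y) y∈ = ball-trans r 1 (ball-sym r y∈) (∈-expand⁺ʳ (x∈⁅x⁆ _) c~y)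

  -- Paths coned off by a vertex

  record IsPath (q : ℕ → Fin n) (L : ℕ) : Set where
    field
      injective : ∀ {i j} → i ≤ L → j ≤ L → q i ≡ q j → i ≡ j
      adjacent  : ∀ {t} → t < L → q t ~ q (suc t)

  PathChord : (ℕ → Fin n) → ℕ → Set
  PathChord q L = ∃₂ λ i j → suc i < j × j ≤ L × q i ~ q j

  cone : ∀ {L} → (ℕ → Fin n) → Fin n → Fin (suc (suc L)) → Fin n
  cone q a fzero = a
  cone q a (fsuc i) = q (toℕ i)

  module _ {q : ℕ → Fin n} {L a} (path : IsPath q L) (q≢a : ∀ {t} → t ≤ L → q t ≢ a)
           (a~q₀ : a ~ q 0) (a~q_L : a ~ q L) where
    open IsPath path

    cone-injective : Injective _≡_ _≡_ (cone {L} q a)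
    cone-injective {fzero} {fzero} _ = refl
    cone-injective {fzero} {fsuc j} a≡qj = contradiction (sym a≡qj) (q≢a (toℕ≤pred[n] j))
    cone-injective {fsuc i} {fzero} qi≡a = contradiction qi≡a (q≢a (toℕ≤pred[n] i))
    cone-injective {fsuc i} {fsuc j} qi≡qj =
      cong fsuc (toℕ-injective (injective (toℕ≤pred[n] i) (toℕ≤pred[n] j) qi≡qj))

    cone-adjacent : ∀ (i j : Fin (suc (suc L))) → Consecutive G i j → cone q a i ~ cone q a j
    cone-adjacent fzero (fsuc fzero) (inj₁ refl) = a~q₀
    cone-adjacent (fsuc i) (fsuc j) (inj₁ 1+j≡2+i) =
      subst (λ t → q (toℕ i) ~ q t) (sym j≡1+i) (adjacent (subst (_≤ L) j≡1+i (toℕ≤pred[n] j)))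
      where
      j≡1+i : toℕ j ≡ suc (toℕ i)
      j≡1+i = suc-injective 1+j≡2+i
    cone-adjacent (fsuc i) fzero (inj₂ (1+i≡1+L , _)) =
      subst (λ t → q t ~ a) (sym (suc-injective 1+i≡1+L)) (~-sym a~q_L)
    cone-adjacent fzero fzero (inj₁ ())
    cone-adjacent fzero (fsuc (fsuc _)) (inj₁ ())
    cone-adjacent (fsuc _) fzero (inj₁ ())
    cone-adjacent fzero _ (inj₂ (() , _))
    cone-adjacent (fsuc _) (fsuc _) (inj₂ (_ , ()))

    cone-chord : HasChord G (suc (suc L)) (cone q a) → PathChord q L ⊎ ∃ λ t → 0 < t × t < L × a ~ q t
    cone-chord (fzero , fzero , 0≢0 , _) = contradiction refl 0≢0
    cone-chord (fzero , fsuc j , _ , ¬c , ¬c′ , a~qj) =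
      inj₂ (toℕ j , ≤∧≢⇒< z≤n (λ 0≡j → ¬c (inj₁ (cong suc (sym 0≡j)))) ,
                    ≤∧≢⇒< (toℕ≤pred[n] j) (λ j≡L → ¬c′ (inj₂ (cong suc j≡L , refl))) , a~qj)
    cone-chord (fsuc i , fzero , _ , ¬c , ¬c′ , qi~a) =
      inj₂ (toℕ i , ≤∧≢⇒< z≤n (λ 0≡i → ¬c′ (inj₁ (cong suc (sym 0≡i)))) ,
                    ≤∧≢⇒< (toℕ≤pred[n] i) (λ i≡L → ¬c (inj₂ (cong suc i≡L , refl))) , ~-sym qi~a)
    cone-chord (fsuc i , fsuc j , i≢j , ¬c , ¬c′ , qi~qj) with <-cmp (toℕ i) (toℕ j)
    ... | tri< i<j _ _ =
      inj₁ (toℕ i , toℕ j , ≤∧≢⇒< i<j (λ 1+i≡j → ¬c (inj₁ (cong suc (sym 1+i≡j)))) , toℕ≤pred[n] j ,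
            qi~qj)
    ... | tri≈ _ i≡j _ = contradiction (cong fsuc (toℕ-injective i≡j)) i≢j
    ... | tri> _ _ j<i =
      inj₁ (toℕ j , toℕ i , ≤∧≢⇒< j<i (λ 1+j≡i → ¬c′ (inj₁ (cong suc (sym 1+j≡i)))) , toℕ≤pred[n] i ,
            ~-sym qi~qj)

    chordal⇒cone-chord : Chordal G → 2 ≤ L → PathChord q L ⊎ ∃ λ t → 0 < t × t < L × a ~ q t
    chordal⇒cone-chord chordal 2≤L =
      cone-chord (chordal (suc (suc L)) (s≤s (s≤s 2≤L)) (cone q a) (cone-injective , cone-adjacent))

  -- A shortest detour walk is an induced path; unless it is a single edge, closing it up
  -- through a would give a chordless cycle of length at least 4.
  module _ (chordal : Chordal G) {a y z : Fin n} (a~y : a ~ y) (a~z : a ~ z) where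

    Detour : Fin n → Set
    Detour x = x ≡ y ⊎ x ≡ z ⊎ ¬ Near a x

    private
      Detour⇒≢a : ∀ {x} → Detour x → x ≢ a
      Detour⇒≢a (inj₁ refl) refl = ~-irrefl a~y
      Detour⇒≢a (inj₂ (inj₁ refl)) refl = ~-irrefl a~z
      Detour⇒≢a (inj₂ (inj₂ ¬a≈x)) refl = ¬a≈x (inj₁ refl)

      interior-≁a : ∀ {L} (w : Walk Detour y z L) → IsPath (at w) L → ∀ {t} → 0 < t → t < L → ¬ a ~ at w t
      interior-≁a w path {t} 0<t t<L with at-P w t
      ... | inj₁ wt≡y =
        contradiction (IsPath.injective path (<⇒≤ t<L) z≤n (trans wt≡y (sym (at-source w)))) (≢-sym (<⇒≢ 0<t))
      ... | inj₂ (inj₁ wt≡z) =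
        contradiction (IsPath.injective path (<⇒≤ t<L) ≤-refl (trans wt≡z (sym (at-target w)))) (<⇒≢ t<L)
      ... | inj₂ (inj₂ ¬a≈wt) = ¬a≈wt ∘ inj₂

      shorten-path : ∀ {L} (w : Walk Detour y z L) → 2 ≤ L → IsPath (at w) L →
                     ∃ λ L′ → L′ < L × Walk Detour y z L′
      shorten-path w 2≤L path
        with chordal⇒cone-chord path (λ {t} _ → Detour⇒≢a (at-P w t))
               (subst (a ~_) (sym (at-source w)) a~y) (subst (a ~_) (sym (at-target w)) a~z) chordal 2≤L
      ... | inj₁ (i , j , 1+i<j , j≤L , wi~wj) = cut-chord w 1+i<j j≤L wi~wj
      ... | inj₂ (t , 0<t , t<L , a~wt) = ⊥-elim (interior-≁a w path 0<t t<L a~wt)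

      shorten : ∀ {L} (w : Walk Detour y z L) → 2 ≤ L → ∃ λ L′ → L′ < L × Walk Detour y z L′
      shorten {L} w 2≤L with repeat-or-injective (at w) L
      ... | inj₁ (i , j , i<j , j≤L , wi≡wj) = cut-repeat w i<j j≤L wi≡wj
      ... | inj₂ injective = shorten-path w 2≤L (record { injective = injective ; adjacent = at-~ w })

    detour-neighbours-adjacent : ∀ {L} → y ≢ z → Walk Detour y z L → y ~ z
    detour-neighbours-adjacent y≢z = go (<-wellFounded _)
      where
      go : ∀ {L} → Acc _<_ L → Walk Detour y z L → y ~ z
      go _ (nil _) = contradiction refl y≢z
      go _ (cons _ y~z (nil _)) = y~z
      go (acc shorter) w@(cons _ _ (cons _ _ _)) =
        let _ , L′<L , w′ = shorten w (s≤s (s≤s z≤n)) in go (shorter L′<L) w′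

  IsConnectedSubset : Subset n → Set
  IsConnectedSubset K = ∀ {x y} → x ∈ K → y ∈ K → ∃ λ L → Walk (_∈ K) x y L

  record IsComponent (P : Fin n → Set) (b : Fin n) (C : Subset n) : Set where
    field
      root      : b ∈ C
      ⊆P        : ∀ {x} → x ∈ C → P x
      closed    : ∀ {x y} → x ∈ C → P y → x ~ y → y ∈ C
      connected : IsConnectedSubset C

  module _ {P : Fin n → Set} (P? : Decidable P) {b : Fin n} (pb : P b) where
    private
      grow : Subset n → Subset n
      grow R = subsetOf (λ x → x ∈? R ⊎-dec (P? x ×-dec any? (λ w → w ∈? R ×-dec w ~? x)))

      ⊆grow : ∀ R → R ⊆ grow R
      ⊆grow R = ∈-subsetOf⁺ _ ∘ inj₁

      Reached : Subset n → Set
      Reached R = b ∈ R × (∀ {x} → x ∈ R → P x × ∃ λ L → Walk P b x L)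

      reached-⁅b⁆ : Reached ⁅ b ⁆
      reached-⁅b⁆ = x∈⁅x⁆ b , λ x∈⁅b⁆ →
        subst (λ x → P x × ∃ λ L → Walk P b x L) (sym (x∈⁅y⁆⇒x≡y b x∈⁅b⁆)) (pb , 0 , nil pb)

      reached-grow : ∀ {R} → Reached R → Reached (grow R)
      reached-grow {R} (b∈R , reach) = ⊆grow R b∈R , reach′ ∘ ∈-subsetOf⁻ _
        where
        reach′ : ∀ {x} → x ∈ R ⊎ (P x × ∃ λ w → w ∈ R × w ~ x) → P x × ∃ λ L → Walk P b x L
        reach′ (inj₁ x∈R) = reach x∈R
        reach′ (inj₂ (px , w , w∈R , w~x)) = let _ , L , walk = reach w∈R in px , suc L , snoc walk w~x px

    component : ∃ (IsComponent P b)
    component with inflationary-fixpoint grow ⊆grow Reached reached-grow reached-⁅b⁆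
    ... | C , (b∈C , reach) , grow-C⊆C = C , record
      { root = b∈C ; ⊆P = proj₁ ∘ reach ; closed = closed ; connected = connected }
      where
      closed : ∀ {x y} → x ∈ C → P y → x ~ y → y ∈ C
      closed x∈C py x~y = grow-C⊆C (∈-subsetOf⁺ _ (inj₂ (py , _ , x∈C , x~y)))

      walk-within : ∀ {u v L} → Walk P u v L → u ∈ C → Walk (_∈ C) u v L
      walk-within (nil _) u∈C = nil u∈C
      walk-within (cons _ u~w walk) u∈C = cons u∈C u~w (walk-within walk (closed u∈C (sourceP walk) u~w))

      from-root : ∀ {x} → x ∈ C → ∃ λ L → Walk (_∈ C) b x L
      from-root x∈C = let L , walk = proj₂ (reach x∈C) in L , walk-within walk b∈C

      connected : IsConnectedSubset C
      connected x∈C y∈C = let L , wx = from-root x∈C ; M , wy = from-root y∈C in L + M , reverse wx ++ʷ wy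

  -- Simplicial vertices

  Clique : Subset n → Set
  Clique K = ∀ {x y} → x ∈ K → y ∈ K → x ≢ y → x ~ y

  Simplicial : Subset n → Fin n → Set
  Simplicial W s = s ∈ W × (∀ {x y} → x ∈ W → y ∈ W → s ~ x → s ~ y → x ≢ y → x ~ y)

  DiracProperty : Subset n → Set
  DiracProperty W = Clique W ⊎ ∃₂ λ s t → Simplicial W s × Simplicial W t × ¬ Near s t

  module _ (chordal : Chordal G) where

    -- C is the component of b in G[W ∖ N[a]] and W′ = W ∩ N[C]. As a ∉ W′ the induction
    -- hypothesis applies to W′. Its vertices outside C are neighbours of a and form a clique, so
    -- one of two non-adjacent simplicial vertices of W′ lies in C, and it stays simplicial in W
    -- because all its neighbours in W lie in W′.
    module Separation {W a b} (a∈W : a ∈ W) (b∈W : b ∈ W) (¬a≈b : ¬ Near a b) where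

      private
        far-component : ∃ (IsComponent (λ x → x ∈ W × ¬ Near a x) b)
        far-component = component (λ x → x ∈? W ×-dec ¬? (Near? a x)) (b∈W , ¬a≈b)

      C : Subset n
      C = proj₁ far-component

      open IsComponent (proj₂ far-component)

      W′ : Subset n
      W′ = subsetOf (λ x → x ∈? W ×-dec (x ∈? C ⊎-dec any? (λ c → c ∈? C ×-dec c ~? x)))

      W′⊂W : W′ ⊂ W
      W′⊂W = proj₁ ∘ ∈-subsetOf⁻ _ , a , a∈W , a∉W′
        where
        a∉W′ : a ∉ W′
        a∉W′ a∈W′ with proj₂ (∈-subsetOf⁻ _ a∈W′)
        ... | inj₁ a∈C = proj₂ (⊆P a∈C) (inj₁ refl)
        ... | inj₂ (c , c∈C , c~a) = proj₂ (⊆P c∈C) (inj₂ (~-sym c~a))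

      boundary-adjacent : ∀ {y} → y ∈ W′ → y ∉ C → a ~ y
      boundary-adjacent {y} y∈W′ y∉C with ∈-subsetOf⁻ _ y∈W′
      ... | _ , inj₁ y∈C = contradiction y∈C y∉C
      ... | y∈W , inj₂ (c , c∈C , c~y) with Near? a y
      ...   | yes (inj₁ refl) = contradiction (inj₂ (~-sym c~y)) (proj₂ (⊆P c∈C))
      ...   | yes (inj₂ a~y) = a~y
      ...   | no ¬a≈y = contradiction (closed c∈C (y∈W , ¬a≈y) c~y) y∉C

      boundary-clique : ∀ {y z} → y ∈ W′ → z ∈ W′ → y ∉ C → z ∉ C → y ≢ z → y ~ z
      boundary-clique y∈W′ z∈W′ y∉C z∉C y≢z with ∈-subsetOf⁻ _ y∈W′ | ∈-subsetOf⁻ _ z∈W′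
      ... | _ , inj₁ y∈C | _ = contradiction y∈C y∉C
      ... | _ | _ , inj₁ z∈C = contradiction z∈C z∉C
      ... | _ , inj₂ (c , c∈C , c~y) | _ , inj₂ (c′ , c′∈C , c′~z) =
        detour-neighbours-adjacent chordal (boundary-adjacent y∈W′ y∉C) (boundary-adjacent z∈W′ z∉C) y≢z
          (cons (inj₁ refl) (~-sym c~y) (snoc (mapʷ (inj₂ ∘ inj₂ ∘ proj₂ ∘ ⊆P) (proj₂ (connected c∈C c′∈C)))
                                              c′~z (inj₂ (inj₁ refl))))

      simplicial-in-W : ∀ {s} → s ∈ C → Simplicial W′ s → Simplicial W s
      simplicial-in-W s∈C (_ , clique) =
        proj₁ (⊆P s∈C) , λ x∈W y∈W s~x s~y → clique (shadow x∈W s~x) (shadow y∈W s~y) s~x s~y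
        where
        shadow : ∀ {x} → x ∈ W → _ ~ x → x ∈ W′
        shadow x∈W s~x = ∈-subsetOf⁺ _ (x∈W , inj₂ (_ , s∈C , s~x))

      simplicial-far : DiracProperty W′ → ∃ λ s → Simplicial W s × ¬ Near a s
      simplicial-far (inj₁ clique) =
        b , simplicial-in-W root (∈-subsetOf⁺ _ (b∈W , inj₁ root) , λ x∈ y∈ _ _ → clique x∈ y∈) , ¬a≈b
      simplicial-far (inj₂ (s , t , simp-s , simp-t , ¬s≈t)) with s ∈? C | t ∈? C
      ... | yes s∈C | _ = s , simplicial-in-W s∈C simp-s , proj₂ (⊆P s∈C)
      ... | no _ | yes t∈C = t , simplicial-in-W t∈C simp-t , proj₂ (⊆P t∈C)
      ... | no s∉C | no t∉C =
        contradiction (inj₂ (boundary-clique (proj₁ simp-s) (proj₁ simp-t) s∉C t∉C (¬s≈t ∘ inj₁))) ¬s≈t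

    simplicial-far-from : ∀ {W a b} → a ∈ W → b ∈ W → ¬ Near a b → (∀ {W′} → W′ ⊂ W → DiracProperty W′) →
                          ∃ λ s → Simplicial W s × ¬ Near a s
    simplicial-far-from a∈W b∈W ¬a≈b dirac-below = simplicial-far (dirac-below W′⊂W)
      where open Separation a∈W b∈W ¬a≈b

    dirac : ∀ W → DiracProperty W
    dirac W = go (⊂-wellFounded W)
      where
      go : ∀ {W} → Acc _⊂_ W → DiracProperty W
      go {W} (acc smaller) with any? (λ x → any? (λ y → x ∈? W ×-dec y ∈? W ×-dec ¬? (Near? x y)))
      ... | yes (a , b , a∈W , b∈W , ¬a≈b) =
        let s , simp-s , ¬a≈s = simplicial-far-from a∈W b∈W ¬a≈b (go ∘ smaller)
            t , simp-t , ¬s≈t = simplicial-far-from (proj₁ simp-s) a∈W (¬a≈s ∘ Near-sym) (go ∘ smaller)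
        in inj₂ (s , t , simp-s , simp-t , ¬s≈t)
      ... | no ¬pair = inj₁ λ {x} {y} x∈W y∈W x≢y →
        decidable-stable (x ~? y) (λ ¬x~y → ¬pair (x , y , x∈W , y∈W , [ x≢y , ¬x~y ]′))

    simplicial-exists : ∀ {W x} → x ∈ W → ∃ (Simplicial W)
    simplicial-exists {W} {x} x∈W with dirac W
    ... | inj₁ clique = x , x∈W , λ y∈W z∈W _ _ → clique y∈W z∈W
    ... | inj₂ (s , _ , simp-s , _) = s , simp-s

  -- The Helly property

  Touch : Subset n → Subset n → Set
  Touch P Q = ∃₂ λ x y → x ∈ P × y ∈ Q × Near x y

  NearAll : ∀ {m} → (Fin m → Subset n) → Fin n → Set
  NearAll A c = ∀ i → ∃ λ y → y ∈ A i × Near c y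

  module _ {W : Subset n} {s : Fin n} (simp : Simplicial W s) where

    simplicial-Near : ∀ {x y} → x ∈ W → y ∈ W → s ~ x → s ~ y → Near x y
    simplicial-Near x∈W y∈W s~x s~y with _ ≟ᶠ _
    ... | yes x≡y = inj₁ x≡y
    ... | no x≢y = inj₂ (proj₂ simp x∈W y∈W s~x s~y x≢y)

    bypass : ∀ {K x y L} → K ⊆ W → Walk (_∈ K) x y L → x ≢ s → y ≢ s → ∃ λ L′ → Walk (_∈ K - s) x y L′
    bypass K⊆W (nil x∈K) x≢s _ = 0 , nil (x∈p∧x≢y⇒x∈p-y x∈K x≢s)
    bypass K⊆W (cons {y = v} x∈K x~v walk) x≢s y≢s with v ≟ᶠ s
    ... | no v≢s = let L , walk′ = bypass K⊆W walk v≢s y≢s in suc L , cons (x∈p∧x≢y⇒x∈p-y x∈K x≢s) x~v walk′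
    bypass K⊆W (cons x∈K x~s (nil _)) x≢s y≢s | yes refl = contradiction refl y≢s
    bypass K⊆W (cons x∈K x~s (cons s∈K s~u walk)) x≢s y≢s | yes refl
      with simplicial-Near (K⊆W x∈K) (K⊆W (sourceP walk)) (~-sym x~s) s~u
    ... | inj₁ refl = bypass K⊆W walk x≢s y≢s
    ... | inj₂ x~u = let L , walk′ = bypass K⊆W walk (~⇒≢ (~-sym s~u)) y≢s
                     in suc L , cons (x∈p∧x≢y⇒x∈p-y x∈K x≢s) x~u walk′

    Replaces : Fin n → Fin n → Set
    Replaces x x′ = x′ ≡ x ⊎ (x ≡ s × s ~ x′)

    replace : ∀ {K x} → IsConnectedSubset K → (∃ λ z → z ∈ K × z ≢ s) → x ∈ K →
              ∃ λ x′ → x′ ∈ K - s × Replaces x x′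
    replace {x = x} conn (z , z∈K , z≢s) x∈K with x ≟ᶠ s
    ... | no x≢s = x , x∈p∧x≢y⇒x∈p-y x∈K x≢s , inj₁ refl
    ... | yes refl with conn x∈K z∈K
    ...   | _ , nil _ = contradiction refl z≢s
    ...   | _ , cons _ s~y walk = _ , x∈p∧x≢y⇒x∈p-y (sourceP walk) (~⇒≢ (~-sym s~y)) , inj₂ (refl , s~y)

    Near-replaced : ∀ {x y x′ y′} → x′ ∈ W → y′ ∈ W → x′ ≢ s → y′ ≢ s →
                    Replaces x x′ → Replaces y y′ → Near x y → Near x′ y′
    Near-replaced _ _ _ _ (inj₁ refl) (inj₁ refl) x≈y = x≈y
    Near-replaced x′∈W y′∈W x′≢s _ (inj₁ refl) (inj₂ (refl , s~y′)) x′≈s =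
      simplicial-Near x′∈W y′∈W (~-sym (Near∧≢⇒~ x′≈s x′≢s)) s~y′
    Near-replaced x′∈W y′∈W _ y′≢s (inj₂ (refl , s~x′)) (inj₁ refl) s≈y′ =
      simplicial-Near x′∈W y′∈W s~x′ (Near∧≢⇒~ s≈y′ (≢-sym y′≢s))
    Near-replaced x′∈W y′∈W _ _ (inj₂ (refl , s~x′)) (inj₂ (refl , s~y′)) _ =
      simplicial-Near x′∈W y′∈W s~x′ s~y′

    module Peel {m} {A : Fin m → Subset n} (A⊆W : ∀ i → A i ⊆ W) (conn : ∀ i → IsConnectedSubset (A i))
                (escapes : ∀ i → ∃ λ z → z ∈ A i × z ≢ s) where

      peeled⊆W-s : ∀ i → A i - s ⊆ W - s
      peeled⊆W-s i x∈ = x∈p∧x≢y⇒x∈p-y (A⊆W i (p─q⊆p _ _ x∈)) (x∈p-y⇒x≢y x∈)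

      peeled-nonempty : ∀ i → Nonempty (A i - s)
      peeled-nonempty i = let z , z∈ , z≢s = escapes i in z , x∈p∧x≢y⇒x∈p-y z∈ z≢s

      peeled-connected : ∀ i → IsConnectedSubset (A i - s)
      peeled-connected i x∈ y∈ =
        bypass (A⊆W i) (proj₂ (conn i (p─q⊆p _ _ x∈) (p─q⊆p _ _ y∈))) (x∈p-y⇒x≢y x∈) (x∈p-y⇒x≢y y∈)

      peeled-touch : ∀ {i j} → Touch (A i) (A j) → Touch (A i - s) (A j - s)
      peeled-touch {i} {j} (x , y , x∈ , y∈ , x≈y) =
        let x′ , x′∈ , x↦x′ = replace (conn i) (escapes i) x∈
            y′ , y′∈ , y↦y′ = replace (conn j) (escapes j) y∈
        in x′ , y′ , x′∈ , y′∈ , Near-replaced (A⊆W i (p─q⊆p _ _ x′∈)) (A⊆W j (p─q⊆p _ _ y′∈))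
                                               (x∈p-y⇒x≢y x′∈) (x∈p-y⇒x≢y y′∈) x↦x′ y↦y′ x≈y

  walk-within-ball : ∀ {P v x u L} j {k} → x ∈ ball G j v → Walk P x u L → j + L ≤ k →
                     Walk (_∈ ball G k v) x u L
  walk-within-ball j x∈ (nil _) j+0≤k = nil (ball-mono (≤-trans (m≤m+n j 0) j+0≤k) x∈)
  walk-within-ball j x∈ (cons {L = L} _ x~y w) j+1+L≤k =
    cons (ball-mono (≤-trans (m≤m+n j _) j+1+L≤k) x∈) x~y
         (walk-within-ball (suc j) (∈-expand⁺ʳ x∈ x~y) w (≤-trans (≤-reflexive (sym (+-suc j L))) j+1+L≤k))

  ball-connected : ∀ k v → IsConnectedSubset (ball G k v)
  ball-connected k v x∈ y∈ =
    let L , L≤k , wx = ball⇒walk k x∈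
        M , M≤k , wy = ball⇒walk k y∈
    in L + M , reverse (walk-within-ball 0 (x∈⁅x⁆ v) wx L≤k) ++ʷ walk-within-ball 0 (x∈⁅x⁆ v) wy M≤k

  balls-touch : ∀ k {x y} → y ∈ ball G (k + suc k) x → Touch (ball G k x) (ball G k y)
  balls-touch k {y = y} y∈ with ball⇒walk (k + suc k) y∈
  ... | L , L≤ , w with L ≤? k
  ...   | yes L≤k = y , y , walk⇒ball w L≤k , ball-centre k y , inj₁ refl
  ...   | no L≰k =
    at w k , at w (suc k) ,
    walk⇒ball (prefix w k (<⇒≤ k<L)) ≤-refl ,
    walk⇒ball (reverse (suffix w (suc k) k<L)) (m≤n+o⇒m∸n≤o L (suc k) (subst (L ≤_) (+-suc k k) L≤)) ,
    inj₂ (at-~ w k<L)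
    where
    k<L : k < L
    k<L = ≰⇒> L≰k

  module _ (chordal : Chordal G) where

    -- Peel off a simplicial vertex s of W: either some A i ⊆ ⁅ s ⁆, and s is near every A j, or
    -- every A i - s is still nonempty, connected and touching the others, as any two neighbours
    -- of s in W are Near.
    helly : ∀ {m} (A : Fin m → Subset n) → Fin m → (∀ i → Nonempty (A i)) → (∀ i → IsConnectedSubset (A i)) →
            (∀ i j → Touch (A i) (A j)) → ∃ (NearAll A)
    helly {m} A i₀ = go (⊂-wellFounded ⊤) A (λ _ _ → ∈⊤)
      where
      go : ∀ {W} → Acc _⊂_ W → (A : Fin m → Subset n) → (∀ i → A i ⊆ W) → (∀ i → Nonempty (A i)) →
           (∀ i → IsConnectedSubset (A i)) → (∀ i j → Touch (A i) (A j)) → ∃ (NearAll A)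
      go (acc smaller) A A⊆W nonempty conn touch with simplicial-exists chordal (A⊆W i₀ (proj₂ (nonempty i₀)))
      ... | s , simp with any? (λ i → A i ⊆? ⁅ s ⁆)
      ...   | yes (i , Ai⊆⁅s⁆) = s , λ j →
        let x , y , x∈ , y∈ , x≈y = touch i j in y , y∈ , subst (λ u → Near u y) (x∈⁅y⁆⇒x≡y s (Ai⊆⁅s⁆ x∈)) x≈y
      ...   | no ¬Ai⊆⁅s⁆ =
        let c , near = go (smaller (x∈p⇒p-x⊂p (proj₁ simp))) (λ i → A i - s) peeled⊆W-s peeled-nonempty
                          peeled-connected (λ i j → peeled-touch (touch i j))
        in c , λ i → let y , y∈ , c≈y = near i in y , p─q⊆p _ _ y∈ , c≈y
        where
        escapes : ∀ i → ∃ λ z → z ∈ A i × z ≢ s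
        escapes i = let z , z∈ , z∉⁅s⁆ = ⊈⇒∃∉ (λ Ai⊆⁅s⁆ → ¬Ai⊆⁅s⁆ (i , Ai⊆⁅s⁆)) in z , z∈ , x∉⁅y⁆⇒x≢y z∉⁅s⁆
        open Peel simp A⊆W conn escapes

    chordal-radius : ∀ {D} → Fin n → (∀ x y → x ∈ ball G D y) → ∃ λ c → ∀ u → u ∈ ball G (suc ⌊ D /2⌋) c
    chordal-radius {D} v₀ within-D =
      let c , near = helly (ball G k) v₀ (λ x → x , ball-centre k x) (ball-connected k)
                           (λ x y → balls-touch k (ball-mono (n≤⌊n/2⌋+1+⌊n/2⌋ D) (within-D y x)))
      in c , λ u → let y , y∈ , c≈y = near u in Near⇒ball-suc k c≈y y∈
      where
      k : ℕ
      k = ⌊ D /2⌋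

  -- Multipackings along a geodesic

  module Geodesic {a b L} (w : Walk U b a L) (shortest : ∀ r → a ∈ ball G r b → L ≤ r) where

    gap : ∀ {i j} s → i ≤ j → j ≤ L → at w j ∈ ball G s (at w i) → j ≤ i + s
    gap {i} {j} s i≤j j≤L wj∈ = +-cancelʳ-≤ (L ∸ j) j (i + s) (begin
      j + (L ∸ j)        ≡⟨ m+[n∸m]≡n j≤L ⟩
      L                  ≤⟨ shortest _ a∈ ⟩
      i + (s + (L ∸ j))  ≡⟨ +-assoc i s (L ∸ j) ⟨
      i + s + (L ∸ j)    ∎)
      where
      open Data.Nat.Properties.≤-Reasoning
      a∈ : a ∈ ball G (i + (s + (L ∸ j))) b
      a∈ = ball-trans (s + (L ∸ j)) i (ball-trans (L ∸ j) s (walk⇒ball (suffix w j j≤L) ≤-refl) wj∈)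
                      (walk⇒ball (prefix w i (≤-trans i≤j j≤L)) ≤-refl)

    milestone : ℕ → Fin n
    milestone i = at w (3 * i)

    everyThird : Subset n
    everyThird = image (suc ⌊ L /3⌋) milestone

    3i≤L : ∀ {i} → i < suc ⌊ L /3⌋ → 3 * i ≤ L
    3i≤L i< = ≤-trans (*-monoʳ-≤ 3 (≤-pred i<)) (3*⌊n/3⌋≤n L)

    everyThird-size : suc ⌊ L /3⌋ ≤ ∣ everyThird ∣
    everyThird-size = ∣image∣≥ _ _ distinct
      where
      distinct : ∀ {i j} → i < j → j < suc ⌊ L /3⌋ → milestone i ≢ milestone j
      distinct {i} {j} i<j j< wi≡wj = <⇒≱ i<j (*-cancelˡ-≤ 3 (≤-trans
        (gap 0 (*-monoʳ-≤ 3 (<⇒≤ i<j)) (3i≤L j<) (subst (_∈ ⁅ milestone i ⁆) wi≡wj (x∈⁅x⁆ _)))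
        (≤-reflexive (+-identityʳ (3 * i)))))

    -- By gap, milestones i ≤ j in a common ball of radius r satisfy 3j ≤ 3i + 2r, so they lie
    -- among the r milestones starting at the first one in the ball.
    window : ∀ v r → 1 ≤ r → ∃ λ f → ball G r v ∩ everyThird ⊆ image r f
    window v r 1≤r with nonempty? (ball G r v ∩ everyThird)
    ... | no empty = (λ _ → v) , λ x∈ → contradiction (_ , x∈) empty
    ... | yes (x , x∈) with x∈p∩q⁻ (ball G r v) everyThird x∈
    ...   | x∈ball , x∈M with ∈-image⁻ (suc ⌊ L /3⌋) milestone x∈M
    ...     | j₀ , _ , refl with least-witness (λ i → milestone i ∈? ball G r v) {j₀} x∈ball
    ...       | i₀ , i₀∈ball , least = (milestone ∘ (i₀ +_)) , contained
      where
      contained : ball G r v ∩ everyThird ⊆ image r (milestone ∘ (i₀ +_))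
      contained y∈ with x∈p∩q⁻ (ball G r v) everyThird y∈
      ... | y∈ball , y∈M with ∈-image⁻ (suc ⌊ L /3⌋) milestone y∈M
      ...   | j , j< , refl = subst (_∈ image r _) (cong milestone (m+[n∸m]≡n i₀≤j)) (∈-image⁺ r _ j∸i₀<r)
        where
        i₀≤j : i₀ ≤ j
        i₀≤j = least j y∈ball

        j<i₀+r : j < i₀ + r
        j<i₀+r = 3j≤3i+2r⇒j<i+r 1≤r (gap (2 * r) (*-monoʳ-≤ 3 i₀≤j) (3i≤L j<)
                   (ball-mono (≤-reflexive (cong (r +_) (sym (+-identityʳ r))))
                              (ball-trans r r y∈ball (ball-sym r i₀∈ball))))

        j∸i₀<r : j ∸ i₀ < r
        j∸i₀<r = ≤-trans (∸-monoˡ-< j<i₀+r i₀≤j) (≤-reflexive (m+n∸m≡n i₀ r))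

    everyThird-multipacking : IsMultipacking G everyThird
    everyThird-multipacking v r 1≤r =
      let f , ⊆image = window v r 1≤r in ≤-trans (p⊆q⇒∣p∣≤∣q∣ ⊆image) (∣image∣≤ r f)

  geodesic-multipacking : ∀ {a b L} → Walk U b a L → (∀ r → a ∈ ball G r b → L ≤ r) →
                          ∃ λ M → IsMultipacking G M × suc ⌊ L /3⌋ ≤ ∣ M ∣
  geodesic-multipacking w shortest = everyThird , everyThird-multipacking , everyThird-size
    where open Geodesic w shortest

  -- Diameter and broadcast domination

  Dist-exists : Connected G → ∀ u v → ∃ (Dist G u v)
  Dist-exists connected u v = let r , u∈ = connected u v in least-witness (λ r → u ∈? ball G r v) {r} u∈

  diameter-ball : ∀ {D} → IsDiameter G D → ∀ u v → u ∈ ball G D v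
  diameter-ball (bounded , _) u v = let _ , (u∈ , _) , d≤D = bounded u v in ball-mono d≤D u∈

  diameter-minimal : ∀ {D D′} → IsDiameter G D → IsDiameter G D′ → D ≤ D′
  diameter-minimal (_ , a , b , _ , D-least) (bounded′ , _) =
    let d , (a∈ , _) , d≤D′ = bounded′ a b in ≤-trans (D-least d a∈) d≤D′

  1≤diameter : ∀ {g D} → Fin n → IsBroadcastDomNumber G g → IsDiameter G D → 1 ≤ D
  1≤diameter v₀ ((_ , broadcast , dominating , _) , _) diam =
    let v , 1≤fv , _ = dominating v₀ in ≤-trans 1≤fv (broadcast v _ diam)

  multipacking-number≥ : ∀ {m D} → IsMultipackingNumber G m → IsDiameter G D → suc ⌊ D /3⌋ ≤ m
  multipacking-number≥ {D = D} (_ , maximal) (_ , a , b , a∈ , D-least) =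
    let L , L≤D , w = ball⇒walk D a∈
        M , multipacking , size = geodesic-multipacking w (λ r a∈′ → ≤-trans L≤D (D-least r a∈′))
        L≡D = ≤-antisym L≤D (D-least L (walk⇒ball w ≤-refl))
    in ≤-trans (subst (λ L → suc ⌊ L /3⌋ ≤ ∣ M ∣) L≡D size) (maximal M multipacking)

  broadcast-number≤radius : ∀ {g D R c} → IsBroadcastDomNumber G g → IsDiameter G D → 1 ≤ R → R ≤ D →
                            (∀ u → u ∈ ball G R c) → g ≤ R
  broadcast-number≤radius {R = R} {c} (_ , minimal) diam 1≤R R≤D covers =
    subst (_ ≤_) (sum-pointBroadcast c R) (minimal (pointBroadcast c R) broadcast dominating)
    where
    broadcast : IsBroadcast G (pointBroadcast c R)
    broadcast v D′ diam′ = ≤-trans (pointBroadcast≤ c R v) (≤-trans R≤D (diameter-minimal diam diam′))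

    dominating : IsDominating G (pointBroadcast c R)
    dominating u = c , subst (1 ≤_) (sym centre) 1≤R , subst (λ r → u ∈ ball G r c) (sym centre) (covers u)
      where
      centre : pointBroadcast c R c ≡ R
      centre = pointBroadcast-centre c R

diameter-exists : ∀ {n} (G : Graph (suc n)) → Connected G → ∃ (IsDiameter G)
diameter-exists {n} G connected =
  d a b , (λ u v → d u v , proj₂ (dist u v) , ≤diam u v) , a , b , proj₂ (dist a b)
  where
  dist : ∀ u v → ∃ (Dist G u v)
  dist = Dist-exists G connected

  d : Fin (suc n) → Fin (suc n) → ℕ
  d u v = proj₁ (dist u v)

  farthest : Fin (suc n) → Fin (suc n)
  farthest u = proj₁ (argmax (d u))

  a b : Fin (suc n)
  a = proj₁ (argmax (λ u → d u (farthest u)))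
  b = farthest a

  ≤diam : ∀ u v → d u v ≤ d a b
  ≤diam u v = ≤-trans (proj₂ (argmax (d u)) v) (proj₂ (argmax (λ u → d u (farthest u))) u)

mainTheorem6 : ∀ (n : ℕ) (G : Graph n) → Connected G → Chordal G →
    ∀ (g m : ℕ) → IsBroadcastDomNumber G g → IsMultipackingNumber G m →
    g ≤ ⌈ 3 * m /2⌉
mainTheorem6 zero G _ _ g m ((_ , _ , _ , cost≡g) , _) _ = subst (_≤ ⌈ 3 * m /2⌉) cost≡g z≤n
mainTheorem6 (suc n) G connected chordal g m γb mp =
  let D , diam = diameter-exists G connected
      c , covers = chordal-radius G chordal {D} fzero (diameter-ball G diam)
      1+⌊D/2⌋≤D = 1+⌊n/2⌋≤n (1≤diameter G fzero γb diam)
  in begin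
    g                        ≤⟨ broadcast-number≤radius G γb diam (s≤s z≤n) 1+⌊D/2⌋≤D covers ⟩
    suc ⌊ D /2⌋              ≤⟨ 1+⌊n/2⌋≤⌈3[1+⌊n/3⌋]/2⌉ D ⟩
    ⌈ 3 * suc ⌊ D /3⌋ /2⌉    ≤⟨ ⌈n/2⌉-mono (*-monoʳ-≤ 3 (multipacking-number≥ G mp diam)) ⟩
    ⌈ 3 * m /2⌉              ∎
  where open Data.Nat.Properties.≤-Reasoning
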